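{- Let $H$ be a bicolored graph. Then $H$ is inevitable if and only if (at least) one of the following holds: (a) there is a partition $V(H)=L\sqcup R$ such that every edge with both endpoints in $L$ or both endpoints in $R$ is red, every edge between $L$ and $R$ is blue, and either (1) $H$ contains no walk $v_0v_1v_2v_3$ whose edges $v_0v_1,v_1v_2,v_2v_3$ are blue, red, blue respectively, or (2) $H$ contains no path on three edges whose edges are red, blue, red in order; (b) the same as (a) with the roles of red and blue interchanged throughout.
   Context: A bicolored graph is a simple graph whose edges are each colored red or blue. $H$ is embeddable in $G$ if there is an injective map $V(H)\to V(G)$ sending every edge of $H$ to an edge of $G$ of the same color. An unavoidable $t$-graph is a bicolored $K_{2t}$ in which one color class is either a clique on $t$ vertices (Type 1) or two vertex-disjoint cliques on $t$ vertices each (Type 2), all other edges having the other color. A bicolored graph $H$ is inevitable if for all sufficiently large $t$ it can be embedded both in a Type 1 unavoidable $t$-graph and in a Type 2 unavoidable $t$-graph. -}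

module Defs where

open import Data.Nat using (ℕ; _+_; _<?_; _≤_)
open import Data.Fin using (Fin; toℕ; _≟_)
open import Data.Bool using (Bool; true; false; _∧_; not; if_then_else_)
open import Data.Bool.Properties using (∧-comm)
open import Data.Maybe using (Maybe; just; nothing)
open import Data.Product using (Σ; _×_; _,_; ∃)
open import Data.Sum using (_⊎_)
open import Relation.Nullary using (¬_; yes; no)
open import Relation.Nullary.Decidable using (⌊_⌋)
open import Relation.Binary.PropositionalEquality using (_≡_; _≢_; refl; sym; cong; cong₂)
open import Function.Definitions using (Injective)

data Color : Set where
  red blue : Color

swap : Color → Color
swap red  = blue
swap blue = red

-- A bicolored graph: a simple graph on vertex set Fin n; edge u v is
-- 'nothing' if uv is not an edge, and 'just c' if uv is an edge of colour c.
record BiGraph : Set where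
  field
    n     : ℕ
    edge  : Fin n → Fin n → Maybe Color
    esym  : ∀ u v → edge u v ≡ edge v u
    loopless : ∀ u → edge u u ≡ nothing
open BiGraph public

Embeds : BiGraph → BiGraph → Set
Embeds H G = Σ (Fin (n H) → Fin (n G)) λ f →
  Injective _≡_ _≡_ f × (∀ u v c → edge H u v ≡ just c → edge G (f u) (f v) ≡ just c)

private
  eqB-sym : ∀ {m} (u v : Fin m) → ⌊ u ≟ v ⌋ ≡ ⌊ v ≟ u ⌋
  eqB-sym u v with u ≟ v | v ≟ u
  ... | yes _ | yes _ = refl
  ... | no _  | no _  = refl
  ... | yes p | no q  = Data.Empty.⊥-elim (q (sym p)) where import Data.Empty
  ... | no p  | yes q = Data.Empty.⊥-elim (p (sym q)) where import Data.Empty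

  eqB-refl : ∀ {m} (u : Fin m) → ⌊ u ≟ u ⌋ ≡ true
  eqB-refl u with u ≟ u
  ... | yes _ = refl
  ... | no q  = Data.Empty.⊥-elim (q refl) where import Data.Empty

  sameB : Bool → Bool → Bool
  sameB true  true  = true
  sameB false false = true
  sameB _     _     = false

  sameB-comm : ∀ a b → sameB a b ≡ sameB b a
  sameB-comm true  true  = refl
  sameB-comm true  false = refl
  sameB-comm false true  = refl
  sameB-comm false false = refl

completeOn : (m : ℕ) (c : Color) (inC : Fin m → Fin m → Bool)
  → (∀ u v → inC u v ≡ inC v u) → BiGraph
completeOn m c inC inC-sym = record
  { n = m
  ; edge = e
  ; esym = λ u v → cong₂ (λ a b → if a then nothing else just (if b then c else swap c))
                         (eqB-sym u v) (inC-sym u v)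
  ; loopless = λ u → cong (λ a → if a then nothing else just (if inC u u then c else swap c))
                          (eqB-refl u)
  }
  where
  e : Fin m → Fin m → Maybe Color
  e u v = if ⌊ u ≟ v ⌋ then nothing else just (if inC u v then c else swap c)

firstBlock : (t : ℕ) → Fin (t + t) → Bool
firstBlock t i = ⌊ toℕ i <? t ⌋

type1 : (t : ℕ) → Color → BiGraph
type1 t c = completeOn (t + t) c (λ u v → firstBlock t u ∧ firstBlock t v)
  (λ u v → ∧-comm (firstBlock t u) (firstBlock t v))

type2 : (t : ℕ) → Color → BiGraph
type2 t c = completeOn (t + t) c (λ u v → sameB (firstBlock t u) (firstBlock t v))
  (λ u v → sameB-comm (firstBlock t u) (firstBlock t v))

Inevitable : BiGraph → Set
Inevitable H = ∃ λ T → ∀ t → T ≤ t →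
  (∃ λ c → Embeds H (type1 t c)) × (∃ λ c → Embeds H (type2 t c))

-- Condition (a) with colour 'c' playing the role of red (and swap c of blue):
-- a partition side : V(H) → Bool (L = true, R = false) with all edges inside
-- a part of colour c and all edges across of colour swap c, and either
-- (1) no walk v0v1v2v3 with colours swap c, c, swap c, or
-- (2) no path (distinct vertices) v0v1v2v3 with colours c, swap c, c.
NoWalk : (H : BiGraph) → Color → Color → Color → Set
NoWalk H a b d = ¬ (∃ λ (v0 : Fin (n H)) → ∃ λ v1 → ∃ λ v2 → ∃ λ v3 →
  edge H v0 v1 ≡ just a × edge H v1 v2 ≡ just b × edge H v2 v3 ≡ just d)

NoPath : (H : BiGraph) → Color → Color → Color → Set
NoPath H a b d = ¬ (∃ λ (v0 : Fin (n H)) → ∃ λ v1 → ∃ λ v2 → ∃ λ v3 →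
  (v0 ≢ v1 × v0 ≢ v2 × v0 ≢ v3 × v1 ≢ v2 × v1 ≢ v3 × v2 ≢ v3) ×
  edge H v0 v1 ≡ just a × edge H v1 v2 ≡ just b × edge H v2 v3 ≡ just d)

Cond : (H : BiGraph) → Color → Set
Cond H c = ∃ λ (side : Fin (n H) → Bool) →
  (∀ u v d → edge H u v ≡ just d → side u ≡ side v → d ≡ c) ×
  (∀ u v d → edge H u v ≡ just d → side u ≢ side v → d ≡ swap c) ×
  (NoWalk H (swap c) c (swap c) ⊎ NoPath H c (swap c) c)

module Submission where

-- Both kinds of unavoidable t-graph are complete graphs on two
-- blocks of t vertices whose edge colour depends only on the blocks of its
-- endpoints, via a pattern  col : Bool → Bool → Color  ('pattern1' for Type 1,
-- 'pattern2' for Type 2).  Once t ≥ |V(H)|, any assignment of the vertices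
-- of H to blocks can be realised injectively, so H embeds in such a graph iff
-- some side function s on V(H) makes every edge uv have colour col (s u) (s v)
-- ('Compatible').  Compatibility is then translated into the paper's terms:
--   * with pattern2 and colour c, it is the partition part of condition (a)/(b);
--   * with pattern1 and colour e, it says that H has no walk coloured e, ē, e
--     (take s u = "u meets an e-edge").
-- Finally, given the partition, a walk coloured c, c̄, c is automatically a
-- path, so "Type 1 embedding for some colour" is exactly alternative (1) or (2)
-- of the condition.  The theorem combines these equivalences at t = T + |V(H)|.

open import Defs
open import Data.Sum using (_⊎_)
open import Function.Bundles using (_⇔_)

open import Data.Sum using (inj₁; inj₂)
open import Function.Bundles using (mk⇔; Equivalence)
open import Data.Nat using (ℕ; _+_; _<?_; _≤_)
open import Data.Nat.Properties using (m≤m+n; m≤n+m; m+n≮m)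
open import Data.Fin using (Fin; toℕ; _↑ˡ_; _↑ʳ_; inject≤)
open import Data.Fin.Properties
  using (toℕ-↑ˡ; toℕ-↑ʳ; toℕ<n; ↑ˡ-injective; ↑ʳ-injective; inject≤-injective; any?)
import Data.Fin.Properties as Fin
open import Data.Bool using (Bool; true; false; T; _∧_; if_then_else_)
import Data.Bool.Properties as Bool
open import Data.Maybe using (just)
open import Data.Maybe.Properties using (just-injective)
import Data.Maybe.Properties as Maybe
open import Data.Product using (_×_; _,_; ∃)
open import Relation.Nullary using (¬_; yes; no; Dec; contradiction)
open import Relation.Nullary.Decidable using (⌊_⌋; toWitness; fromWitness)
open import Relation.Binary.PropositionalEquality
  using (_≡_; _≢_; refl; sym; trans; cong; cong₂; subst; module ≡-Reasoning)
open import Function.Definitions using (Injective)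
import Function.Properties.Equivalence as ⇔

private
  variable
    t : ℕ
    c d e : Color
    H : BiGraph

swap-≢ : ∀ c → swap c ≢ c
swap-≢ red  ()
swap-≢ blue ()

swap-involutive : ∀ c → swap (swap c) ≡ c
swap-involutive red  = refl
swap-involutive blue = refl

_≟ᶜ_ : (d e : Color) → Dec (d ≡ e)
red  ≟ᶜ red  = yes refl
blue ≟ᶜ blue = yes refl
red  ≟ᶜ blue = no λ ()
blue ≟ᶜ red  = no λ ()

≢⇒swap : d ≢ e → d ≡ swap e
≢⇒swap {red}  {red}  d≢e = contradiction refl d≢e
≢⇒swap {red}  {blue} _   = refl
≢⇒swap {blue} {red}  _   = refl
≢⇒swap {blue} {blue} d≢e = contradiction refl d≢e

edge-distinct : ∀ (H : BiGraph) {u v} → edge H u v ≡ just d → u ≢ v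
edge-distinct H {u} uv refl with () ← trans (sym uv) (loopless H u)

-- Colour patterns on two blocks (true = first block, false = second block).

pattern1 : Color → Bool → Bool → Color
pattern1 c a b = if a ∧ b then c else swap c

pattern2 : Color → Bool → Bool → Color
pattern2 c true  true  = c
pattern2 c false false = c
pattern2 c _     _     = swap c

pattern1-inner : ∀ a b → e ≡ pattern1 e a b → T a × T b
pattern1-inner {e} true  true  _  = _ , _
pattern1-inner {e} true  false eq = contradiction (sym eq) (swap-≢ e)
pattern1-inner {e} false _     eq = contradiction (sym eq) (swap-≢ e)

pattern1-inside : ∀ {a b} → T a → T b → pattern1 e a b ≡ e
pattern1-inside {a = true} {true} _ _ = refl

pattern1-outer : ∀ a b → ¬ (T a × T b) → pattern1 e a b ≡ swap e
pattern1-outer true  true  ¬ab = contradiction _ ¬ab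
pattern1-outer true  false _   = refl
pattern1-outer false _     _   = refl

pattern2-same : ∀ {a b} → a ≡ b → pattern2 c a b ≡ c
pattern2-same {a = true}  refl = refl
pattern2-same {a = false} refl = refl

pattern2-across : ∀ {a b} → a ≢ b → pattern2 c a b ≡ swap c
pattern2-across {a = true}  {true}  a≢b = contradiction refl a≢b
pattern2-across {a = true}  {false} _   = refl
pattern2-across {a = false} {true}  _   = refl
pattern2-across {a = false} {false} a≢b = contradiction refl a≢b

BlockColoured : (G : BiGraph) → (Fin (n G) → Bool) → (Bool → Bool → Color) → Set
BlockColoured G block col =
  ∀ x y → x ≢ y → edge G x y ≡ just (col (block x) (block y))

Compatible : (H : BiGraph) → (Bool → Bool → Color) → (Fin (n H) → Bool) → Set
Compatible H col s = ∀ u v d → edge H u v ≡ just d → d ≡ col (s u) (s v)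

Placement : (m k : ℕ) → (Fin k → Bool) → (Fin m → Bool) → Set
Placement m k block s =
  ∃ λ (f : Fin m → Fin k) → Injective _≡_ _≡_ f × (∀ u → block (f u) ≡ s u)

type1-blockColoured : ∀ t c → BlockColoured (type1 t c) (firstBlock t) (pattern1 c)
type1-blockColoured t c x y x≢y with x Fin.≟ y
... | yes x≡y = contradiction x≡y x≢y
... | no _    = refl

type2-blockColoured : ∀ t c → BlockColoured (type2 t c) (firstBlock t) (pattern2 c)
type2-blockColoured t c x y x≢y with x Fin.≟ y | firstBlock t x | firstBlock t y
... | yes x≡y | _     | _     = contradiction x≡y x≢y
... | no _    | true  | true  = refl
... | no _    | true  | false = refl
... | no _    | false | true  = refl
... | no _    | false | false = refl

module _ {G H : BiGraph} {block : Fin (n G) → Bool} {col : Bool → Bool → Color}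
         (coloured : BlockColoured G block col) where

  embedding⇒compatible : Embeds H G → ∃ (Compatible H col)
  embedding⇒compatible (f , _ , preserves) = (λ u → block (f u)) , compatible
    where
    compatible : Compatible H col (λ u → block (f u))
    compatible u v d uv = just-injective (begin
      just d                                  ≡⟨ sym fuv ⟩
      edge G (f u) (f v)                      ≡⟨ coloured (f u) (f v) (edge-distinct G fuv) ⟩
      just (col (block (f u)) (block (f v)))  ∎)
      where
      open ≡-Reasoning
      fuv : edge G (f u) (f v) ≡ just d
      fuv = preserves u v d uv

  compatible⇒embedding : ∀ {s} → Placement (n H) (n G) block s → Compatible H col s → Embeds H G
  compatible⇒embedding {s} (f , f-injective , f-block) compatible = f , f-injective , preserves
    where
    preserves : ∀ u v d → edge H u v ≡ just d → edge G (f u) (f v) ≡ just d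
    preserves u v d uv = begin
      edge G (f u) (f v)                      ≡⟨ coloured (f u) (f v) (λ eq → edge-distinct H uv (f-injective eq)) ⟩
      just (col (block (f u)) (block (f v)))  ≡⟨ cong just (cong₂ col (f-block u) (f-block v)) ⟩
      just (col (s u) (s v))                  ≡⟨ cong just (sym (compatible u v d uv)) ⟩
      just d                                  ∎
      where open ≡-Reasoning

  embeds⇔compatible : (∀ s → Placement (n H) (n G) block s) → Embeds H G ⇔ ∃ (Compatible H col)
  embeds⇔compatible place =
    mk⇔ embedding⇒compatible (λ (s , compatible) → compatible⇒embedding (place s) compatible)

atBlock : Bool → Fin t → Fin (t + t)
atBlock {t} true  i = i ↑ˡ t
atBlock {t} false i = t ↑ʳ i

firstBlock-atBlock : ∀ b (i : Fin t) → firstBlock t (atBlock b i) ≡ b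
firstBlock-atBlock {t} true i rewrite toℕ-↑ˡ i t with toℕ i <? t
... | yes _   = refl
... | no i≮t  = contradiction (toℕ<n i) i≮t
firstBlock-atBlock {t} false i rewrite toℕ-↑ʳ t i with t + toℕ i <? t
... | yes t+i<t = contradiction t+i<t (m+n≮m t (toℕ i))
... | no  _     = refl

atBlock-sameBlock : ∀ a b (i j : Fin t) → atBlock a i ≡ atBlock b j → a ≡ b
atBlock-sameBlock {t} a b i j eq = begin
  a                          ≡⟨ sym (firstBlock-atBlock a i) ⟩
  firstBlock t (atBlock a i) ≡⟨ cong (firstBlock t) eq ⟩
  firstBlock t (atBlock b j) ≡⟨ firstBlock-atBlock b j ⟩
  b                          ∎
  where open ≡-Reasoning

atBlock-injective : ∀ a b (i j : Fin t) → atBlock a i ≡ atBlock b j → i ≡ j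
atBlock-injective a b i j eq with atBlock-sameBlock a b i j eq
atBlock-injective {t} true  .true  i j eq | refl = ↑ˡ-injective t i j eq
atBlock-injective {t} false .false i j eq | refl = ↑ʳ-injective t i j eq

twoBlocks : ∀ {m} → m ≤ t → ∀ s → Placement m (t + t) (firstBlock t) s
twoBlocks {t} {m} m≤t s = place , place-injective , λ u → firstBlock-atBlock (s u) (inject≤ u m≤t)
  where
  place : Fin m → Fin (t + t)
  place u = atBlock (s u) (inject≤ u m≤t)
  place-injective : Injective _≡_ _≡_ place
  place-injective {u} {v} eq =
    inject≤-injective m≤t m≤t u v (atBlock-injective (s u) (s v) _ _ eq)

NoSandwich : BiGraph → Color → Set
NoSandwich H e = NoWalk H e (swap e) e

Partition : BiGraph → Color → Set
Partition H c = ∃ λ (side : Fin (n H) → Bool) →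
  (∀ u v d → edge H u v ≡ just d → side u ≡ side v → d ≡ c) ×
  (∀ u v d → edge H u v ≡ just d → side u ≢ side v → d ≡ swap c)

partition⇔compatible : Partition H c ⇔ ∃ (Compatible H (pattern2 c))
partition⇔compatible {H} {c} = mk⇔ toCompatible fromCompatible
  where
  toCompatible : Partition H c → ∃ (Compatible H (pattern2 c))
  toCompatible (side , inside , across) = side , compatible
    where
    compatible : Compatible H (pattern2 c) side
    compatible u v d uv with side u Bool.≟ side v
    ... | yes same = trans (inside u v d uv same) (sym (pattern2-same same))
    ... | no diff  = trans (across u v d uv diff) (sym (pattern2-across diff))

  fromCompatible : ∃ (Compatible H (pattern2 c)) → Partition H c
  fromCompatible (s , compatible) = s
    , (λ u v d uv same → trans (compatible u v d uv) (pattern2-same same))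
    , (λ u v d uv diff → trans (compatible u v d uv) (pattern2-across diff))

meets : (H : BiGraph) → Color → Fin (n H) → Bool
meets H e u = ⌊ any? (λ v → Maybe.≡-dec _≟ᶜ_ (edge H u v) (just e)) ⌋

meets-intro : ∀ (H : BiGraph) e {u} v → edge H u v ≡ just e → T (meets H e u)
meets-intro H e v uv = fromWitness (v , uv)

meets-elim : ∀ (H : BiGraph) e u → T (meets H e u) → ∃ λ v → edge H u v ≡ just e
meets-elim H e u = toWitness

noSandwich⇔compatible : NoSandwich H e ⇔ ∃ (Compatible H (pattern1 e))
noSandwich⇔compatible {H} {e} = mk⇔ (λ free → meets H e , compatible free) forbids
  where
  -- An e, ē, e walk forces its middle edge inside the first block.
  forbids : ∃ (Compatible H (pattern1 e)) → NoSandwich H e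
  forbids (s , compatible) (w , u , v , x , wu , uv , vx)
    with _ , su ← pattern1-inner (s w) (s u) (compatible w u e wu)
       | sv , _ ← pattern1-inner (s v) (s x) (compatible v x e vx) =
    swap-≢ e (trans (compatible u v (swap e) uv) (pattern1-inside su sv))

  -- An ē-edge between two vertices meeting e-edges would be such a walk.
  compatible : NoSandwich H e → Compatible H (pattern1 e) (meets H e)
  compatible free u v d uv with d ≟ᶜ e
  ... | yes refl = sym (pattern1-inside (meets-intro H e v uv) (meets-intro H e u (trans (esym H v u) uv)))
  ... | no d≢e = trans (≢⇒swap d≢e) (sym (pattern1-outer _ _ sandwich))
    where
    sandwich : ¬ (T (meets H e u) × T (meets H e v))
    sandwich (mu , mv) with w , uw ← meets-elim H e u mu | x , vx ← meets-elim H e v mv =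
      free (w , u , v , x , trans (esym H w u) uw , trans uv (cong just (≢⇒swap d≢e)) , vx)

-- Given the partition for c, every walk coloured c, c̄, c is a path: the
-- c-edges stay on one side and the middle c̄-edge crosses over.
partition⇒walk-is-path : Partition H c → NoPath H c (swap c) c → NoSandwich H c
partition⇒walk-is-path {H} {c} (side , inside , across) noPath (w , u , v , x , wu , uv , vx) =
  noPath (w , u , v , x , distinct , wu , uv , vx)
  where
  stays : ∀ {a b} → edge H a b ≡ just c → side a ≡ side b
  stays {a} {b} ab with side a Bool.≟ side b
  ... | yes same = same
  ... | no diff  = contradiction (sym (across a b c ab diff)) (swap-≢ c)
  crosses : ∀ {a b} → edge H a b ≡ just (swap c) → side a ≢ side b
  crosses {a} {b} ab same = swap-≢ c (inside a b (swap c) ab same)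
  distinct : w ≢ u × w ≢ v × w ≢ x × u ≢ v × u ≢ x × v ≢ x
  distinct = edge-distinct H wu
           , (λ w≡v → crosses uv (trans (sym (stays wu)) (cong side w≡v)))
           , (λ w≡x → crosses uv (trans (sym (stays wu)) (trans (cong side w≡x) (sym (stays vx)))))
           , edge-distinct H uv
           , (λ u≡x → crosses uv (trans (cong side u≡x) (sym (stays vx))))
           , edge-distinct H vx

cond⇔ : ∀ H c → Cond H c ⇔ (Partition H c × ∃ (NoSandwich H))
cond⇔ H c = mk⇔ split join
  where
  split : Cond H c → Partition H c × ∃ (NoSandwich H)
  split (side , inside , across , inj₁ noWalk) =
    (side , inside , across) , swap c ,
    subst (λ z → NoWalk H (swap c) z (swap c)) (sym (swap-involutive c)) noWalk
  split (side , inside , across , inj₂ noPath) =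
    (side , inside , across) , c , partition⇒walk-is-path {H = H} (side , inside , across) noPath
  join : Partition H c × ∃ (NoSandwich H) → Cond H c
  join ((side , inside , across) , e , free) with e ≟ᶜ c
  ... | yes refl = side , inside , across , inj₂ λ (w , u , v , x , _ , walk) → free (w , u , v , x , walk)
  ... | no e≢c with refl ← ≢⇒swap e≢c =
    side , inside , across , inj₁ (subst (λ z → NoWalk H (swap c) z (swap c)) (swap-involutive c) free)

type1-embeds⇔ : ∀ H e → n H ≤ t → Embeds H (type1 t e) ⇔ NoSandwich H e
type1-embeds⇔ {t} H e large = ⇔.trans
  (embeds⇔compatible {type1 t e} {H} {firstBlock t} {pattern1 e} (type1-blockColoured t e) (twoBlocks large))
  (⇔.sym (noSandwich⇔compatible {H}))

type2-embeds⇔ : ∀ H c → n H ≤ t → Embeds H (type2 t c) ⇔ Partition H c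
type2-embeds⇔ {t} H c large = ⇔.trans
  (embeds⇔compatible {type2 t c} {H} {firstBlock t} {pattern2 c} (type2-blockColoured t c) (twoBlocks large))
  (⇔.sym (partition⇔compatible {H}))

proposition3p2 : (H : BiGraph) → Inevitable H ⇔ (Cond H red ⊎ Cond H blue)
proposition3p2 H = mk⇔ necessary sufficient
  where
  open Equivalence

  byColour : ∀ c → Cond H c → Cond H red ⊎ Cond H blue
  byColour red  = inj₁
  byColour blue = inj₂

  necessary : Inevitable H → Cond H red ⊎ Cond H blue
  necessary (T , embedsBeyondT) =
    let large = m≤n+m (n H) T
        (e , type1-embedding) , (c , type2-embedding) = embedsBeyondT (T + n H) (m≤m+n T (n H))
    in byColour c (from (cond⇔ H c)
         (to (type2-embeds⇔ H c large) type2-embedding , e , to (type1-embeds⇔ H e large) type1-embedding))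

  inevitable : ∀ c → Cond H c → Inevitable H
  inevitable c cond =
    let partition , e , free = to (cond⇔ H c) cond
    in n H , λ t large → (e , from (type1-embeds⇔ H e large) free) , (c , from (type2-embeds⇔ H c large) partition)

  sufficient : Cond H red ⊎ Cond H blue → Inevitable H
  sufficient (inj₁ condRed)  = inevitable red condRed
  sufficient (inj₂ condBlue) = inevitable blue condBlue
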